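{- Let $K$ be a positive integer. For any large enough integer $n$ and any integer $h\ge K$, let $E$ be a set with $|E|=n$ partitioned as $E=B\cup R\cup P$ with $|B|=n-K$, $|R|=K-1$, $|P|=1$. Then there exists a colorwise-symmetric function $f\colon 2^E\to\mathbb{Z}_+$ such that: (i) $f$ is monotone and submodular; (ii) $f(b+1,0,0)=f(b,1,0)$ for all $0\le b\le n-K-1$; (iii) $f(K,0,0)=f(K-1,1,0)=hK+\frac{(K-1)K}{2}$ and $f(K-1,0,1)=(K-1)^2+\frac{h(h+1)}{2}$; (iv) $f(0,K-1,1)=(K-1)(h+K-1)+\frac{h(h+1)}{2}$.
   Context: Elements of $B$, $R$, $P$ are called blue, red and purple respectively. A function $f\colon 2^E\to\mathbb{Z}_+$ is colorwise-symmetric if $f(S)$ depends only on the numbers $b=|S\cap B|$, $r=|S\cap R|$, $p=|S\cap P|$; one then writes $f(b,r,p)$ for this value. Submodular: $f(S\cup\{e\})-f(S)\ge f(T\cup\{e\})-f(T)$ for $S\subseteq T\subsetneq E$, $e\in E\setminus T$; monotone: $f(S)\le f(T)$ for $S\subseteq T$. -}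

module Defs where

open import Data.Nat using (ℕ; _≤_; _+_)
open import Data.Bool using (Bool; true; false)
open import Data.Fin using (Fin)
open import Data.Vec using (tabulate)
open import Data.Fin.Subset using (Subset; _∩_; _∪_; _⊆_; _∉_; ⁅_⁆; ∣_∣)

data Color : Set where
  blue red purple : Color

isColor : Color → Color → Bool
isColor blue   blue   = true
isColor red    red    = true
isColor purple purple = true
isColor _      _      = false

classOf : ∀ {n} → (Fin n → Color) → Color → Subset n
classOf c k = tabulate (λ i → isColor k (c i))

Monotone : ∀ {n} → (Subset n → ℕ) → Set
Monotone {n} f = (S T : Subset n) → S ⊆ T → f S ≤ f T

-- Submodular: f(S ∪ {e}) - f(S) ≥ f(T ∪ {e}) - f(T) for S ⊆ T, e ∉ T,
-- written additively (equivalent over the integers).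
Submodular : ∀ {n} → (Subset n → ℕ) → Set
Submodular {n} f = (S T : Subset n) (e : Fin n) → S ⊆ T → e ∉ T →
  f (T ∪ ⁅ e ⁆) + f S ≤ f (S ∪ ⁅ e ⁆) + f T

-- The colorwise-symmetric function determined by g : f(S) = g(|S∩B|, |S∩R|, |S∩P|).
symFun : ∀ {n} → (Fin n → Color) → (ℕ → ℕ → ℕ → ℕ) → Subset n → ℕ
symFun c g S = g (∣ S ∩ classOf c blue ∣) (∣ S ∩ classOf c red ∣) (∣ S ∩ classOf c purple ∣)

module Submission where

-- With k = K - 1 and M = h + k, for b blue, r red and p purple elements put
--   G b r 0 = E b r + Φ b,     G b r (p + 1) = E b r + Φ h,
-- where Φ b = Σ_{i<b} (h ∸ i) is a potential that one purple element completes,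
-- and E is determined by its gains: a blue gains k up to h blues, then k ∸ 1 up
-- to M blues, then nothing, and k ∸ r once r ≥ 1 reds are present; the first red
-- gains like a blue that also advances Φ, every later red gains M ∸ b.

open import Defs
open import Data.Nat using (ℕ; zero; suc; _+_; _*_; _∸_; _≤_; _<_; _/_; z≤n; s≤s; _≤?_; _<?_)
open import Data.Nat.Properties
open import Data.Nat.DivMod using (m*n/n≡m)
open import Data.Nat.Tactic.RingSolver using (solve-∀)
open import Algebra.Properties.CommutativeSemigroup +-commutativeSemigroup
  using (interchange; xy∙z≈xz∙y; xy∙z≈zx∙y)
open import Data.Bool using (Bool; true; false; _∧_)
open import Data.Bool.Properties using (∨-identityʳ)
open import Data.Fin using (Fin; zero; suc)
open import Data.Vec using (_∷_; lookup; here; there)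
open import Data.Vec.Properties using (lookup∘tabulate)
open import Data.Fin.Subset using (Subset; _∩_; _∪_; _⊆_; _∉_; ⁅_⁆; ∣_∣)
open import Data.Fin.Subset.Properties using (∪-identityʳ; p⊆q⇒∣p∣≤∣q∣; x∈p∩q⁺; x∈p∩q⁻; ∣p∩q∣≤∣q∣)
open import Data.Product using (_,_; _×_; ∃; proj₁; proj₂)
open import Data.Sum using (inj₁; inj₂)
open import Relation.Nullary using (yes; no)
open import Relation.Nullary.Negation using (contradiction)
open import Relation.Binary.PropositionalEquality

climb : (f : ℕ → ℕ) {i j : ℕ} → (∀ {l} → l < j → f l ≤ f (suc l)) → i ≤ j → f i ≤ f j
climb f {j = zero} grows z≤n = ≤-refl
climb f {i} {suc j} grows i≤1+j with m≤n⇒m<n∨m≡n i≤1+j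
... | inj₁ i<1+j = ≤-trans (climb f (λ l<j → grows (m<n⇒m<1+n l<j)) (≤-pred i<1+j)) (grows ≤-refl)
... | inj₂ refl = ≤-refl

descend : (f : ℕ → ℕ) → (∀ l → f (suc l) ≤ f l) → ∀ {i j} → i ≤ j → f j ≤ f i
descend f shrinks {i} {j} i≤j with m≤n⇒∃[o]m+o≡n i≤j
... | o , refl = go o
  where
  go : ∀ o → f (i + o) ≤ f i
  go zero rewrite +-identityʳ i = ≤-refl
  go (suc o) rewrite +-suc i o = ≤-trans (shrinks (i + o)) (go o)

ind : Bool → ℕ
ind true = 1
ind false = 0

Point : Set
Point = Color → ℕ

point : ℕ → ℕ → ℕ → Point
point b r p blue = b
point b r p red = r
point b r p purple = p

at : (ℕ → ℕ → ℕ → ℕ) → Point → ℕ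
at g x = g (x blue) (x red) (x purple)

at-cong : (g : ℕ → ℕ → ℕ → ℕ) {x y : Point} → (∀ col → x col ≡ y col) → at g x ≡ at g y
at-cong g x≗y = cong₂ (λ b rp → g b (proj₁ rp) (proj₂ rp)) (x≗y blue) (cong₂ _,_ (x≗y red) (x≗y purple))

_≤ᴾ_ : Point → Point → Set
x ≤ᴾ y = ∀ col → x col ≤ y col

bump : Color → Point → Point
bump d x col = ind (isColor col d) + x col

bump-mono : ∀ d {x y} → x ≤ᴾ y → bump d x ≤ᴾ bump d y
bump-mono d x≤y col = +-monoʳ-≤ (ind (isColor col d)) (x≤y col)

counts : ∀ {n} → (Fin n → Color) → Subset n → Point
counts c S col = ∣ S ∩ classOf c col ∣

card-insert : ∀ {n} (T X : Subset n) {e : Fin n} → e ∉ T →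
  ∣ (T ∪ ⁅ e ⁆) ∩ X ∣ ≡ ind (lookup X e) + ∣ T ∩ X ∣
card-insert (true ∷ T) X {zero} e∉T = contradiction here e∉T
card-insert (false ∷ T) (true ∷ X) {zero} _ rewrite ∪-identityʳ T = refl
card-insert (false ∷ T) (false ∷ X) {zero} _ rewrite ∪-identityʳ T = refl
card-insert (t ∷ T) (x ∷ X) {suc e} e∉T rewrite ∨-identityʳ t =
  card-cons (t ∧ x) {(T ∪ ⁅ e ⁆) ∩ X} {T ∩ X} (card-insert T X (λ e∈T → e∉T (there e∈T)))
  where
  card-cons : ∀ {m} s {A B : Subset m} {i} → ∣ A ∣ ≡ ind i + ∣ B ∣ →
    ∣ s ∷ A ∣ ≡ ind i + ∣ s ∷ B ∣
  card-cons true {i = i} eq = trans (cong suc eq) (sym (+-suc (ind i) _))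
  card-cons false eq = eq

counts-insert : ∀ {n} (c : Fin n → Color) (T : Subset n) {e : Fin n} → e ∉ T →
  ∀ col → counts c (T ∪ ⁅ e ⁆) col ≡ bump (c e) (counts c T) col
counts-insert c T {e} e∉T col =
  trans (card-insert T (classOf c col) e∉T)
        (cong (λ t → ind t + counts c T col) (lookup∘tabulate (λ i → isColor col (c i)) e))

counts-mono : ∀ {n} (c : Fin n → Color) {S T : Subset n} → S ⊆ T → counts c S ≤ᴾ counts c T
counts-mono c {S} S⊆T col = p⊆q⇒∣p∣≤∣q∣ λ x∈S∩C →
  let (x∈S , x∈C) = x∈p∩q⁻ S (classOf c col) x∈S∩C in x∈p∩q⁺ (S⊆T x∈S , x∈C)

InBox : ℕ → Point → Set
InBox R x = x red ≤ R × x purple ≤ 1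

inBox-down : ∀ {R x y} → x ≤ᴾ y → InBox R y → InBox R x
inBox-down x≤y (r≤R , p≤1) = ≤-trans (x≤y red) r≤R , ≤-trans (x≤y purple) p≤1

counts-inBox : ∀ {n R} (c : Fin n → Color) → ∣ classOf c red ∣ ≤ R → ∣ classOf c purple ∣ ≤ 1 →
  (S : Subset n) → InBox R (counts c S)
counts-inBox c red≤R purple≤1 S =
  ≤-trans (∣p∩q∣≤∣q∣ S _) red≤R , ≤-trans (∣p∩q∣≤∣q∣ S _) purple≤1

record DiminishingMarginals (R : ℕ) (g : ℕ → ℕ → ℕ → ℕ) : Set where
  field
    marginal : Color → Point → ℕ
    step     : ∀ d x → InBox R (bump d x) → at g (bump d x) ≡ at g x + marginal d x
    antitone : ∀ d {x y} → x ≤ᴾ y → InBox R (bump d y) → marginal d y ≤ marginal d x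

module _ {R : ℕ} {g : ℕ → ℕ → ℕ → ℕ} (D : DiminishingMarginals R g) where
  open DiminishingMarginals D

  grow : ∀ d x → InBox R (bump d x) → at g x ≤ at g (bump d x)
  grow d x box = ≤-trans (m≤m+n _ _) (≤-reflexive (sym (step d x box)))

  at-mono : ∀ {x y} → x ≤ᴾ y → InBox R y → at g x ≤ at g y
  at-mono {x} {y} x≤y (yr≤R , yp≤1) = ≤-trans raise-blue (≤-trans raise-red raise-purple)
    where
    xp≤1 = ≤-trans (x≤y purple) yp≤1
    raise-blue : g (x blue) (x red) (x purple) ≤ g (y blue) (x red) (x purple)
    raise-blue = climb (λ b → g b (x red) (x purple))
      (λ {b} _ → grow blue (point b (x red) (x purple)) (≤-trans (x≤y red) yr≤R , xp≤1)) (x≤y blue)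
    raise-red : g (y blue) (x red) (x purple) ≤ g (y blue) (y red) (x purple)
    raise-red = climb (λ r → g (y blue) r (x purple))
      (λ {r} r<yr → grow red (point (y blue) r (x purple)) (≤-trans r<yr yr≤R , xp≤1)) (x≤y red)
    raise-purple : g (y blue) (y red) (x purple) ≤ g (y blue) (y red) (y purple)
    raise-purple = climb (λ p → g (y blue) (y red) p)
      (λ {p} p<yp → grow purple (point (y blue) (y red) p) (yr≤R , ≤-trans p<yp yp≤1)) (x≤y purple)

  exchange : ∀ d {x y} → x ≤ᴾ y → InBox R (bump d y) →
    at g (bump d y) + at g x ≤ at g (bump d x) + at g y
  exchange d {x} {y} x≤y box = begin
    at g (bump d y) + at g x          ≡⟨ cong (_+ at g x) (step d y box) ⟩
    at g y + marginal d y + at g x    ≡⟨ xy∙z≈zx∙y (at g y) (marginal d y) (at g x) ⟩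
    at g x + at g y + marginal d y    ≤⟨ +-monoʳ-≤ (at g x + at g y) (antitone d x≤y box) ⟩
    at g x + at g y + marginal d x    ≡⟨ xy∙z≈xz∙y (at g x) (at g y) (marginal d x) ⟩
    at g x + marginal d x + at g y    ≡⟨ cong (_+ at g y) (sym (step d x (inBox-down (bump-mono d x≤y) box))) ⟩
    at g (bump d x) + at g y          ∎
    where open ≤-Reasoning

  symFun-monotone : ∀ {n} (c : Fin n → Color) → ∣ classOf c red ∣ ≤ R → ∣ classOf c purple ∣ ≤ 1 →
    Monotone (symFun c g)
  symFun-monotone c red≤R purple≤1 S T S⊆T =
    at-mono (counts-mono c S⊆T) (counts-inBox c red≤R purple≤1 T)

  symFun-submodular : ∀ {n} (c : Fin n → Color) → ∣ classOf c red ∣ ≤ R → ∣ classOf c purple ∣ ≤ 1 →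
    Submodular (symFun c g)
  symFun-submodular c red≤R purple≤1 S T e S⊆T e∉T
    rewrite at-cong g (counts-insert c T e∉T) | at-cong g (counts-insert c S (λ e∈S → e∉T (S⊆T e∈S))) =
    exchange (c e) (counts-mono c S⊆T)
      (inBox-down (λ col → ≤-reflexive (sym (counts-insert c T e∉T col)))
                  (counts-inBox c red≤R purple≤1 (T ∪ ⁅ e ⁆)))

triangle : ℕ → ℕ
triangle zero = 0
triangle (suc n) = triangle n + n

triangle-double : ∀ n → triangle (suc n) * 2 ≡ n * suc n
triangle-double zero = refl
triangle-double (suc n) = begin
  (triangle (suc n) + suc n) * 2      ≡⟨ *-distribʳ-+ 2 (triangle (suc n)) (suc n) ⟩
  triangle (suc n) * 2 + suc n * 2    ≡⟨ cong (_+ suc n * 2) (triangle-double n) ⟩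
  n * suc n + suc n * 2               ≡⟨ ring n ⟩
  suc n * suc (suc n)                 ∎
  where
  open ≡-Reasoning
  ring : ∀ n → n * suc n + suc n * 2 ≡ suc n * suc (suc n)
  ring = solve-∀

triangle-half : ∀ n → (n * suc n) / 2 ≡ triangle (suc n)
triangle-half n = trans (cong (_/ 2) (sym (triangle-double n))) (m*n/n≡m (triangle (suc n)) 2)

triangle-pair : ∀ n → triangle n + triangle (suc n) ≡ n * n
triangle-pair zero = refl
triangle-pair (suc n) = begin
  triangle (suc n) + (triangle (suc n) + suc n)   ≡⟨ regroup (triangle n) n ⟩
  triangle n + triangle (suc n) + (n + suc n)     ≡⟨ cong (_+ (n + suc n)) (triangle-pair n) ⟩
  n * n + (n + suc n)                             ≡⟨ square n ⟩
  suc n * suc n                                   ∎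
  where
  open ≡-Reasoning
  regroup : ∀ t n → t + n + (t + n + suc n) ≡ t + (t + n) + (n + suc n)
  regroup = solve-∀
  square : ∀ n → n * n + (n + suc n) ≡ suc n * suc n
  square = solve-∀

splitAtZero : (ℕ → ℕ) → (ℕ → ℕ → ℕ) → ℕ → ℕ → ℕ
splitAtZero f₀ f₊ b zero = f₀ b
splitAtZero f₀ f₊ b (suc r) = f₊ b (suc r)

splitAtZero-antitone : ∀ {f₀ f₊} →
  (∀ {b b'} → b ≤ b' → f₀ b' ≤ f₀ b) →
  (∀ {b b' r r'} → b ≤ b' → r ≤ r' → f₊ b' r' ≤ f₊ b r) →
  (∀ b → f₊ b 1 ≤ f₀ b) →
  ∀ {b b' r r'} → b ≤ b' → r ≤ r' → splitAtZero f₀ f₊ b' r' ≤ splitAtZero f₀ f₊ b r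
splitAtZero-antitone f₀-anti f₊-anti first {r = zero} {zero} b≤b' _ = f₀-anti b≤b'
splitAtZero-antitone f₀-anti f₊-anti first {b} {r = zero} {suc r'} b≤b' _ =
  ≤-trans (f₊-anti b≤b' (s≤s z≤n)) (first b)
splitAtZero-antitone f₀-anti f₊-anti first {r = suc r} {suc r'} b≤b' r≤r' = f₊-anti b≤b' r≤r'

∸-suc : ∀ {m n} → n < m → m ∸ n ≡ suc (m ∸ suc n)
∸-suc n<m = +-∸-assoc 1 n<m

module Construction (h k : ℕ) where

  M : ℕ
  M = h + k

  Φ : ℕ → ℕ
  Φ zero = 0
  Φ (suc b) = Φ b + (h ∸ b)

  Φ-mono : ∀ {b b'} → b ≤ b' → Φ b ≤ Φ b'
  Φ-mono = climb Φ (λ {b} _ → m≤m+n (Φ b) (h ∸ b))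

  Φ-saturates : ∀ {b} → h ≤ b → Φ b ≡ Φ h
  Φ-saturates {b} h≤b with m≤n⇒∃[o]m+o≡n h≤b
  ... | o , refl = go o
    where
    go : ∀ o → Φ (h + o) ≡ Φ h
    go zero rewrite +-identityʳ h = refl
    go (suc o) rewrite +-suc h o | m≤n⇒m∸n≡0 (m≤m+n h o) = trans (+-identityʳ _) (go o)

  Φ-≤-Φh : ∀ b → Φ b ≤ Φ h
  Φ-≤-Φh b with b ≤? h
  ... | yes b≤h = Φ-mono b≤h
  ... | no b≰h = ≤-reflexive (Φ-saturates (≰⇒≥ b≰h))

  gain₀ : ℕ → ℕ
  gain₀ b with b ≤? h
  ... | yes _ = k
  ... | no _ with b ≤? M
  ...   | yes _ = k ∸ 1
  ...   | no _ = 0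

  gain₀-early : ∀ {b} → b ≤ h → gain₀ b ≡ k
  gain₀-early {b} b≤h with b ≤? h
  ... | yes _ = refl
  ... | no b≰h = contradiction b≤h b≰h

  gain₀-late : ∀ {b} → h < b → b ≤ M → gain₀ b ≡ k ∸ 1
  gain₀-late {b} h<b b≤M with b ≤? h
  ... | yes b≤h = contradiction b≤h (<⇒≱ h<b)
  ... | no _ with b ≤? M
  ...   | yes _ = refl
  ...   | no b≰M = contradiction b≤M b≰M

  gain₀-spent : ∀ {b} → M < b → gain₀ b ≡ 0
  gain₀-spent {b} M<b with b ≤? h
  ... | yes b≤h = contradiction (≤-trans b≤h (m≤m+n h k)) (<⇒≱ M<b)
  ... | no _ with b ≤? M
  ...   | yes b≤M = contradiction b≤M (<⇒≱ M<b)
  ...   | no _ = refl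

  gain₊ : ℕ → ℕ → ℕ
  gain₊ b r with b <? M
  ... | yes _ = k ∸ r
  ... | no _ = 0

  gain₊-active : ∀ {b} r → b < M → gain₊ b r ≡ k ∸ r
  gain₊-active {b} r b<M with b <? M
  ... | yes _ = refl
  ... | no b≮M = contradiction b<M b≮M

  gain₊-spent : ∀ {b} r → M ≤ b → gain₊ b r ≡ 0
  gain₊-spent {b} r M≤b with b <? M
  ... | yes b<M = contradiction b<M (≤⇒≯ M≤b)
  ... | no _ = refl

  -- Blue gain in E and red gain in E (and G): the first red acts like a
  -- blue element that also advances the purple potential.
  blueGainE : ℕ → ℕ → ℕ
  blueGainE = splitAtZero gain₀ gain₊

  redGain : ℕ → ℕ → ℕ
  redGain = splitAtZero (λ b → gain₀ b + (h ∸ b)) (λ b _ → M ∸ b)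

  E₀ : ℕ → ℕ
  E₀ zero = 0
  E₀ (suc b) = E₀ b + gain₀ b

  E : ℕ → ℕ → ℕ
  E b zero = E₀ b
  E b (suc r) = E₀ (suc b) + (h ∸ b) + r * (M ∸ b)

  G : ℕ → ℕ → ℕ → ℕ
  G b r zero = E b r + Φ b
  G b r (suc p) = E b r + Φ h

  blueGain : ℕ → ℕ → ℕ → ℕ
  blueGain b r zero = blueGainE b r + (h ∸ b)
  blueGain b r (suc p) = blueGainE b r

  purpleGain : ℕ → ℕ
  purpleGain b = Φ h ∸ Φ b

  E-red-step : ∀ b r → E b (suc r) ≡ E b r + redGain b r
  E-red-step b zero = reassoc (E₀ b) (gain₀ b) (h ∸ b)
    where
    reassoc : ∀ e g d → e + g + d + 0 * (M ∸ b) ≡ e + (g + d)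
    reassoc = solve-∀
  E-red-step b (suc r) = one-more (E₀ (suc b) + (h ∸ b)) r (M ∸ b)
    where
    one-more : ∀ a r m → a + suc r * m ≡ a + r * m + m
    one-more = solve-∀

  data Regime (b : ℕ) : Set where
    below   : b < h → Regime b
    between : h ≤ b → b < M → Regime b
    beyond  : M ≤ b → Regime b

  regime : ∀ b → Regime b
  regime b with b <? h | b <? M
  ... | yes b<h | _       = below b<h
  ... | no b≮h  | yes b<M = between (≮⇒≥ b≮h) b<M
  ... | no _    | no b≮M  = beyond (≮⇒≥ b≮M)

  -- Writing k = suc r + d turns the regime identities into ring identities.
  below-identity : ∀ {r} x y → suc r ≤ k → k + x + r * y ≡ suc x + r * suc y + (k ∸ suc r)
  below-identity {r} x y r<k with m≤n⇒∃[o]m+o≡n r<k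
  ... | d , refl rewrite m+n∸m≡n (suc r) d = ring r d x y
    where
    ring : ∀ r d x y → suc r + d + x + r * y ≡ suc x + r * suc y + d
    ring = solve-∀

  between-identity : ∀ {r} y → suc r ≤ k → k ∸ 1 + 0 + r * y ≡ 0 + r * suc y + (k ∸ suc r)
  between-identity {r} y r<k with m≤n⇒∃[o]m+o≡n r<k
  ... | d , refl rewrite m+n∸m≡n (suc r) d = ring r d y
    where
    ring : ∀ r d y → r + d + 0 + r * y ≡ 0 + r * suc y + d
    ring = solve-∀

  -- The heart of the construction: with r ≥ 1 reds present, adding a blue
  -- and then the reds gives the same as adding the reds and then the blue.
  blue-red-commute : ∀ b r → suc r ≤ k →
    gain₀ (suc b) + (h ∸ suc b) + r * (M ∸ suc b) ≡ (h ∸ b) + r * (M ∸ b) + gain₊ b (suc r)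
  blue-red-commute b r r<k with regime b
  ... | below b<h
    rewrite gain₀-early b<h | ∸-suc b<h | ∸-suc (<-≤-trans b<h (m≤m+n h k)) | gain₊-active (suc r) (<-≤-trans b<h (m≤m+n h k))
    = below-identity (h ∸ suc b) (M ∸ suc b) r<k
  ... | between h≤b b<M
    rewrite gain₀-late (s≤s h≤b) b<M | m≤n⇒m∸n≡0 h≤b | m≤n⇒m∸n≡0 (m≤n⇒m≤1+n h≤b)
          | ∸-suc b<M | gain₊-active (suc r) b<M
    = between-identity (M ∸ suc b) r<k
  ... | beyond M≤b
    rewrite gain₀-spent (s≤s M≤b) | m≤n⇒m∸n≡0 (≤-trans (m≤m+n h k) M≤b)
          | m≤n⇒m∸n≡0 (≤-trans (m≤m+n h k) (m≤n⇒m≤1+n M≤b))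
          | m≤n⇒m∸n≡0 M≤b | m≤n⇒m∸n≡0 (m≤n⇒m≤1+n M≤b) | gain₊-spent (suc r) M≤b
    = sym (+-identityʳ (r * 0))

  E-blue-step : ∀ b r → r ≤ k → E (suc b) r ≡ E b r + blueGainE b r
  E-blue-step b zero _ = refl
  E-blue-step b (suc r) r<k = begin
    E₀ (suc b) + gain₀ (suc b) + (h ∸ suc b) + r * (M ∸ suc b)
      ≡⟨ reassoc (E₀ (suc b)) (gain₀ (suc b)) (h ∸ suc b) (r * (M ∸ suc b)) ⟩
    E₀ (suc b) + (gain₀ (suc b) + (h ∸ suc b) + r * (M ∸ suc b))
      ≡⟨ cong (E₀ (suc b) +_) (blue-red-commute b r r<k) ⟩
    E₀ (suc b) + ((h ∸ b) + r * (M ∸ b) + gain₊ b (suc r))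
      ≡⟨ reassoc (E₀ (suc b)) (h ∸ b) (r * (M ∸ b)) (gain₊ b (suc r)) ⟨
    E₀ (suc b) + (h ∸ b) + r * (M ∸ b) + gain₊ b (suc r) ∎
    where
    open ≡-Reasoning
    reassoc : ∀ a x y z → a + x + y + z ≡ a + (x + y + z)
    reassoc = solve-∀

  G-blue-step : ∀ b r p → r ≤ k → G (suc b) r p ≡ G b r p + blueGain b r p
  G-blue-step b r zero r≤k =
    trans (cong (_+ Φ (suc b)) (E-blue-step b r r≤k)) (interchange (E b r) (blueGainE b r) (Φ b) (h ∸ b))
  G-blue-step b r (suc p) r≤k =
    trans (cong (_+ Φ h) (E-blue-step b r r≤k)) (xy∙z≈xz∙y (E b r) (blueGainE b r) (Φ h))

  G-red-step : ∀ b r p → G b (suc r) p ≡ G b r p + redGain b r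
  G-red-step b r zero = trans (cong (_+ Φ b) (E-red-step b r)) (xy∙z≈xz∙y (E b r) (redGain b r) (Φ b))
  G-red-step b r (suc p) = trans (cong (_+ Φ h) (E-red-step b r)) (xy∙z≈xz∙y (E b r) (redGain b r) (Φ h))

  G-purple-step : ∀ b r {p} → suc p ≤ 1 → G b r (suc p) ≡ G b r p + purpleGain b
  G-purple-step b r (s≤s z≤n) =
    trans (cong (E b r +_) (sym (m+[n∸m]≡n (Φ-≤-Φh b)))) (sym (+-assoc (E b r) (Φ b) (purpleGain b)))

  gain₀-≥ : ∀ {b} → b ≤ M → k ∸ 1 ≤ gain₀ b
  gain₀-≥ {b} b≤M with ≤-<-connex b h
  ... | inj₁ b≤h rewrite gain₀-early b≤h = m∸n≤m k 1
  ... | inj₂ h<b rewrite gain₀-late h<b b≤M = ≤-refl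

  gain₀-step : ∀ b → gain₀ (suc b) ≤ gain₀ b
  gain₀-step b with regime b
  ... | below b<h rewrite gain₀-early b<h | gain₀-early (<⇒≤ b<h) = ≤-refl
  ... | between h≤b b<M rewrite gain₀-late (s≤s h≤b) b<M = gain₀-≥ (<⇒≤ b<M)
  ... | beyond M≤b rewrite gain₀-spent (s≤s M≤b) = z≤n

  gain₀-antitone : ∀ {b b'} → b ≤ b' → gain₀ b' ≤ gain₀ b
  gain₀-antitone = descend gain₀ gain₀-step

  gain₊-antitone : ∀ {b b' r r'} → b ≤ b' → r ≤ r' → gain₊ b' r' ≤ gain₊ b r
  gain₊-antitone {b} {b'} {r} {r'} b≤b' r≤r' with <-≤-connex b' M
  ... | inj₁ b'<M rewrite gain₊-active r' b'<M | gain₊-active r (≤-<-trans b≤b' b'<M) = ∸-monoʳ-≤ k r≤r'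
  ... | inj₂ M≤b' rewrite gain₊-spent r' M≤b' = z≤n

  gain₊-≤-gain₀ : ∀ b → gain₊ b 1 ≤ gain₀ b
  gain₊-≤-gain₀ b with <-≤-connex b M
  ... | inj₁ b<M rewrite gain₊-active 1 b<M = gain₀-≥ (<⇒≤ b<M)
  ... | inj₂ M≤b rewrite gain₊-spent 1 M≤b = z≤n

  red-later-≤-first : ∀ b → M ∸ b ≤ gain₀ b + (h ∸ b)
  red-later-≤-first b with ≤-<-connex b h
  ... | inj₁ b≤h rewrite gain₀-early b≤h = ≤-reflexive (trans (+-∸-comm k b≤h) (+-comm (h ∸ b) k))
  ... | inj₂ h<b with ≤-<-connex b M
  ...   | inj₁ b≤M rewrite gain₀-late h<b b≤M | m≤n⇒m∸n≡0 (<⇒≤ h<b) = begin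
    M ∸ b           ≤⟨ ∸-monoʳ-≤ M (subst (_≤ b) (+-comm 1 h) h<b) ⟩
    M ∸ (h + 1)     ≡⟨ [m+n]∸[m+o]≡n∸o h k 1 ⟩
    k ∸ 1           ≡⟨ +-identityʳ (k ∸ 1) ⟨
    k ∸ 1 + 0       ∎
    where open ≤-Reasoning
  ...   | inj₂ M<b rewrite m≤n⇒m∸n≡0 (<⇒≤ M<b) = z≤n

  blueGainE-antitone : ∀ {b b' r r'} → b ≤ b' → r ≤ r' → blueGainE b' r' ≤ blueGainE b r
  blueGainE-antitone = splitAtZero-antitone gain₀-antitone gain₊-antitone gain₊-≤-gain₀

  redGain-antitone : ∀ {b b' r r'} → b ≤ b' → r ≤ r' → redGain b' r' ≤ redGain b r
  redGain-antitone = splitAtZero-antitone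
    (λ b≤b' → +-mono-≤ (gain₀-antitone b≤b') (∸-monoʳ-≤ h b≤b')) (λ b≤b' _ → ∸-monoʳ-≤ M b≤b')
    red-later-≤-first

  blueGain-antitone : ∀ {b b' r r' p p'} → b ≤ b' → r ≤ r' → p ≤ p' → blueGain b' r' p' ≤ blueGain b r p
  blueGain-antitone {p = zero} {zero} b≤b' r≤r' _ = +-mono-≤ (blueGainE-antitone b≤b' r≤r') (∸-monoʳ-≤ h b≤b')
  blueGain-antitone {p = zero} {suc _} b≤b' r≤r' _ = ≤-trans (blueGainE-antitone b≤b' r≤r') (m≤m+n _ _)
  blueGain-antitone {p = suc _} {suc _} b≤b' r≤r' _ = blueGainE-antitone b≤b' r≤r'

  purpleGain-antitone : ∀ {b b'} → b ≤ b' → purpleGain b' ≤ purpleGain b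
  purpleGain-antitone b≤b' = ∸-monoʳ-≤ (Φ h) (Φ-mono b≤b')

  diminishing : DiminishingMarginals k G
  diminishing = record { marginal = marginal ; step = step ; antitone = antitone }
    where
    marginal : Color → Point → ℕ
    marginal blue x = blueGain (x blue) (x red) (x purple)
    marginal red x = redGain (x blue) (x red)
    marginal purple x = purpleGain (x blue)

    step : ∀ d x → InBox k (bump d x) → at G (bump d x) ≡ at G x + marginal d x
    step blue x (r≤k , _) = G-blue-step (x blue) (x red) (x purple) r≤k
    step red x _ = G-red-step (x blue) (x red) (x purple)
    step purple x (_ , p<1) = G-purple-step (x blue) (x red) p<1

    antitone : ∀ d {x y} → x ≤ᴾ y → InBox k (bump d y) → marginal d y ≤ marginal d x
    antitone blue x≤y _ = blueGain-antitone (x≤y blue) (x≤y red) (x≤y purple)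
    antitone red x≤y _ = redGain-antitone (x≤y blue) (x≤y red)
    antitone purple x≤y _ = purpleGain-antitone (x≤y blue)

  Φ-closed : ∀ {b} → b ≤ h → Φ b + triangle b ≡ h * b
  Φ-closed {zero} _ = sym (*-zeroʳ h)
  Φ-closed {suc b} b<h = begin
    Φ b + (h ∸ b) + (triangle b + b)  ≡⟨ interchange (Φ b) (h ∸ b) (triangle b) b ⟩
    Φ b + triangle b + (h ∸ b + b)    ≡⟨ cong₂ _+_ (Φ-closed (<⇒≤ b<h)) (m∸n+n≡m (<⇒≤ b<h)) ⟩
    h * b + h                         ≡⟨ +-comm (h * b) h ⟩
    h + h * b                         ≡⟨ *-suc h b ⟨
    h * suc b                         ∎
    where open ≡-Reasoning

  Φ-full : (h * (h + 1)) / 2 ≡ Φ h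
  Φ-full = begin
    (h * (h + 1)) / 2   ≡⟨ cong (λ m → (h * m) / 2) (+-comm h 1) ⟩
    (h * suc h) / 2     ≡⟨ triangle-half h ⟩
    triangle (suc h)    ≡⟨ +-cancelʳ-≡ (triangle h) (triangle (suc h)) (Φ h) tri+tri≡Φ+tri ⟩
    Φ h                 ∎
    where
    open ≡-Reasoning
    tri+tri≡Φ+tri : triangle (suc h) + triangle h ≡ Φ h + triangle h
    tri+tri≡Φ+tri = trans (+-comm (triangle (suc h)) (triangle h)) (trans (triangle-pair h) (sym (Φ-closed ≤-refl)))

  E₀-early : ∀ {b} → b ≤ suc h → E₀ b ≡ b * k
  E₀-early {zero} _ = refl
  E₀-early {suc b} (s≤s b≤h) =
    trans (cong₂ _+_ (E₀-early (m≤n⇒m≤1+n b≤h)) (gain₀-early b≤h)) (+-comm (b * k) k)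

  E-no-blue : ∀ r → E 0 r ≡ r * M
  E-no-blue zero = refl
  E-no-blue (suc r) = trans (cong (λ g → g + h + r * M) (gain₀-early z≤n)) (cong (_+ r * M) (+-comm k h))

  first-red-as-blue : ∀ b → G b 1 0 ≡ G (suc b) 0 0
  first-red-as-blue b = trans (G-red-step b 0 0) (sym (G-blue-step b 0 0 z≤n))

  value-blues : suc k ≤ h → G (suc k) 0 0 ≡ h * suc k + (k * suc k) / 2
  value-blues K≤h = begin
    E₀ (suc k) + Φ (suc k)
      ≡⟨ cong (_+ Φ (suc k)) (E₀-early (m≤n⇒m≤1+n K≤h)) ⟩
    suc k * k + Φ (suc k)
      ≡⟨ cong (_+ Φ (suc k)) (trans (*-comm (suc k) k) (sym (triangle-double k))) ⟩
    triangle (suc k) * 2 + Φ (suc k)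
      ≡⟨ regroup (triangle (suc k)) (Φ (suc k)) ⟩
    Φ (suc k) + triangle (suc k) + triangle (suc k)
      ≡⟨ cong₂ _+_ (Φ-closed K≤h) (sym (triangle-half k)) ⟩
    h * suc k + (k * suc k) / 2 ∎
    where
    open ≡-Reasoning
    regroup : ∀ t φ → t * 2 + φ ≡ φ + t + t
    regroup = solve-∀

  value-blues-purple : k ≤ suc h → G k 0 1 ≡ k * k + (h * (h + 1)) / 2
  value-blues-purple k≤1+h = cong₂ _+_ (E₀-early k≤1+h) (sym Φ-full)

  value-reds-purple : G 0 k 1 ≡ k * ((h + suc k) ∸ 1) + (h * (h + 1)) / 2
  value-reds-purple =
    cong₂ _+_ (trans (E-no-blue k) (cong (λ m → k * (m ∸ 1)) (sym (+-suc h k)))) (sym Φ-full)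

lemma2p1 : (K : ℕ) → 1 ≤ K →
  ∃ λ (N : ℕ) → (n : ℕ) → N ≤ n → (h : ℕ) → K ≤ h →
  (c : Fin n → Color) →
  ∣ classOf c blue ∣ ≡ n ∸ K → ∣ classOf c red ∣ ≡ K ∸ 1 → ∣ classOf c purple ∣ ≡ 1 →
  ∃ λ (g : ℕ → ℕ → ℕ → ℕ) →
    Monotone (symFun c g) × Submodular (symFun c g) ×
    ((b : ℕ) → b < n ∸ K → g (b + 1) 0 0 ≡ g b 1 0) ×
    g K 0 0 ≡ h * K + ((K ∸ 1) * K) / 2 ×
    g (K ∸ 1) 1 0 ≡ h * K + ((K ∸ 1) * K) / 2 ×
    g (K ∸ 1) 0 1 ≡ (K ∸ 1) * (K ∸ 1) + (h * (h + 1)) / 2 ×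
    g 0 (K ∸ 1) 1 ≡ (K ∸ 1) * ((h + K) ∸ 1) + (h * (h + 1)) / 2
lemma2p1 (suc k) (s≤s z≤n) = 0 , λ n _ h K≤h c _ red≡k purple≡1 →
  let open Construction h k
      red≤k = ≤-reflexive red≡k
      purple≤1 = ≤-reflexive purple≡1
  in G
   , symFun-monotone diminishing c red≤k purple≤1
   , symFun-submodular diminishing c red≤k purple≤1
   , (λ b _ → trans (cong (λ b' → G b' 0 0) (+-comm b 1)) (sym (first-red-as-blue b)))
   , value-blues K≤h
   , trans (first-red-as-blue k) (value-blues K≤h)
   , value-blues-purple (≤-trans (n≤1+n k) (≤-trans K≤h (n≤1+n h)))
   , value-reds-purple
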